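{- For all even integers $b\geq 2$, $k\geq 4$ and $\Delta\geq b$ such that $\Delta\equiv 2\pmod 4$ or $b\equiv 0\pmod 4$, there is a graph $G$ with arboricity at most $b$, maximum degree at most $\Delta$, diameter at most $k$, and at least $\frac{8}{b^2}\left(\frac{b\Delta}{8}\right)^{k/2}$ vertices.
   Context: The arboricity of a graph $G$ is the minimum number of spanning forests whose union is $G$. -}

module Defs where

open import Data.Nat using (ℕ; zero; suc; _≤_)
open import Data.Bool using (Bool; true; false; if_then_else_)
open import Data.Fin using (Fin)
open import Data.List using (List; []; _∷_; _++_; [_]; length; map; allFin)
open import Data.Nat.ListAction using (sum)
open import Data.List.Relation.Unary.Linked using (Linked)
open import Data.List.Relation.Unary.Unique.Propositional using (Unique)
open import Data.Product using (Σ; ∃; _×_)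
open import Relation.Binary.PropositionalEquality using (_≡_)
open import Relation.Nullary using (¬_)

record Graph (n : ℕ) : Set where
  field
    adj    : Fin n → Fin n → Bool
    sym    : ∀ u v → adj u v ≡ adj v u
    irrefl : ∀ v → adj v v ≡ false
open Graph public

Edge : {n : ℕ} → Graph n → Fin n → Fin n → Set
Edge G u v = adj G u v ≡ true

degree : {n : ℕ} → Graph n → Fin n → ℕ
degree {n} G v = sum (map (λ u → if adj G v u then 1 else 0) (allFin n))

MaxDegreeAtMost : {n : ℕ} → Graph n → ℕ → Set
MaxDegreeAtMost G Δ = ∀ v → degree G v ≤ Δ

data Walk {n : ℕ} (G : Graph n) : Fin n → Fin n → ℕ → Set where
  here : ∀ {v} → Walk G v v 0
  step : ∀ {u w v l} → Edge G u w → Walk G w v l → Walk G u v (suc l)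

DiameterAtMost : {n : ℕ} → Graph n → ℕ → Set
DiameterAtMost G k = ∀ u v → ∃ λ l → l ≤ k × Walk G u v l

Cycle : {n : ℕ} → Graph n → Set
Cycle {n} G = Σ (Fin n) λ v → Σ (List (Fin n)) λ ws →
  (2 ≤ length ws) × Unique (v ∷ ws) × Linked (Edge G) (v ∷ ws ++ [ v ])

Forest : {n : ℕ} → Graph n → Set
Forest G = ¬ Cycle G

Subgraph : {n : ℕ} → Graph n → Graph n → Set
Subgraph H G = ∀ u v → Edge H u v → Edge G u v

ArboricityAtMost : {n : ℕ} → Graph n → ℕ → Set
ArboricityAtMost {n} G b = Σ (Fin b → Graph n) λ F →
  (∀ i → Subgraph (F i) G × Forest (F i)) ×
  (∀ u v → Edge G u v → ∃ λ i → Edge (F i) u v)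

-- Put b = 2Q, Δ = 2P and k = 2(r + 2). The vertices are the words of length r + 1 over the
-- alphabet Fin P × Fin Q together with links (s , y , p), where s, p : Fin P and y is a word of
-- length r; the link (s , y , p) is adjacent to the 2Q words (s , q) ∷ y and y ∷ʳ (p , q). So links
-- have degree b and words degree Δ. Numbering the b neighbours of each link, the edges to the t-th
-- neighbours form a star forest centred at words, hence the arboricity is at most b. Going through
-- a link drops the first letter of a word and appends an arbitrary one, so any two words are joined
-- by a walk of length 2(r + 1), and every link is adjacent to a word: the diameter is at most k.
-- The links alone number P²(PQ)ʳ ≥ (8 / b²)(bΔ / 8)^(k/2).

module Submission where

open import Defs
open import Data.Bool using (Bool; true; false; if_then_else_)
open import Data.Bool.Properties using () renaming (_≟_ to _≟ᵇ_)
open import Data.Empty using (⊥)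
open import Data.Fin using (Fin; zero) renaming (_≟_ to _≟ᶠ_)
open import Data.Fin.Patterns using (0F; 1F)
open import Data.Fin.Properties using (any?; *↔×; +↔⊎)
open import Data.List using (List; []; _∷_; _++_; [_]; length; map; allFin)
open import Data.List.Properties using (length-removeAt′; length-map; length-tabulate; length-++)
open import Data.List.Membership.Propositional using (_∈_; _─_)
open import Data.List.Membership.Propositional.Properties using (∈-map⁺; ∈-allFin; ∈-++⁺ˡ; ∈-++⁺ʳ)
open import Data.List.Relation.Unary.All as All using ()
open import Data.List.Relation.Unary.AllPairs using (_∷_)
open import Data.List.Relation.Unary.Any using (here; there)
open import Data.List.Relation.Unary.Linked using (Linked; _∷_)
open import Data.List.Relation.Unary.Unique.Propositional using (Unique)
open import Data.List.Relation.Unary.Unique.Propositional.Properties using (allFin⁺)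
open import Data.Nat using (ℕ; zero; suc; _+_; _*_; _^_; _≤_; z≤n; s≤s)
open import Data.Nat.DivMod using (_/_; _%_; m*n/n≡m)
open import Data.Nat.Divisibility using (_∣_; divides)
open import Data.Nat.ListAction using (sum)
open import Data.Nat.Properties
  using (≤-refl; ≤-reflexive; ≤-trans; +-mono-≤; *-mono-≤; *-monoˡ-≤; *-monoʳ-≤; ^-monoˡ-≤; m≤n+m; module ≤-Reasoning)
open import Data.Nat.Tactic.RingSolver using (solve-∀)
open import Data.Product using (Σ; ∃; ∃₂; _×_; _,_; proj₁; uncurry)
open import Data.Product.Function.NonDependent.Propositional using (_×-↔_)
open import Data.Sum using (_⊎_; inj₁; inj₂; swap)
open import Data.Sum.Function.Propositional using (_⊎-↔_)
open import Data.Sum.Properties using (inj₁-injective; inj₂-injective)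
open import Data.Vec using (Vec; []; _∷_; _∷ʳ_; head; tail; init; last; initLast; uncons)
open import Data.Vec.Properties using (init-∷ʳ; last-∷ʳ)
open import Function using (_∘_; id)
open import Function.Bundles using (mk⇔; _↔_; Inverse; Injection; mk↔ₛ′)
open import Function.Properties.Inverse using (↔-refl; ↔-sym; ↔-trans; ↔⇒↣)
open import Relation.Binary using (Decidable; Symmetric)
open import Relation.Binary.PropositionalEquality using (_≡_; _≢_; refl; trans; cong; cong₂; subst)
import Relation.Binary.PropositionalEquality as ≡
open import Relation.Nullary using (¬_; Dec; yes; no; does; contradiction; _⊎-dec_)
open import Relation.Nullary.Decidable using (dec-true; dec-false; does-⇔)

module FromRelation {n : ℕ} {E : Fin n → Fin n → Set}
  (E? : Decidable E) (E-sym : Symmetric E) (E-irrefl : ∀ v → ¬ E v v) where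

  graph : Graph n
  graph = record
    { adj    = λ u v → does (E? u v)
    ; sym    = λ u v → does-⇔ (mk⇔ E-sym E-sym) (E? u v) (E? v u)
    ; irrefl = λ v → dec-false (E? v v) (E-irrefl v)
    }

  Edge⇒E : ∀ {u v} → Edge graph u v → E u v
  Edge⇒E {u} {v} e with E? u v
  ... | yes uv = uv

  E⇒Edge : ∀ {u v} → E u v → Edge graph u v
  E⇒Edge {u} {v} = dec-true (E? u v)

module Union {n b : ℕ} (F : Fin b → Graph n) where

  UnionEdge : Fin n → Fin n → Set
  UnionEdge u v = ∃ λ t → Edge (F t) u v

  private
    union? : Decidable UnionEdge
    union? u v = any? λ t → adj (F t) u v ≟ᵇ true

    union-sym : Symmetric UnionEdge
    union-sym {u} {v} (t , e) = t , trans (sym (F t) v u) e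

    union-irrefl : ∀ v → ¬ UnionEdge v v
    union-irrefl v (t , e) = contradiction (trans (≡.sym (irrefl (F t) v)) e) λ ()

  open FromRelation union? union-sym union-irrefl public
    renaming (graph to ⋃)

  union-arboricity : (∀ t → Forest (F t)) → ArboricityAtMost ⋃ b
  union-arboricity forest =
    F , (λ t → (λ u v e → E⇒Edge (t , e)) , forest t) , (λ u v e → Edge⇒E e)

_++ʷ_ : ∀ {n} {G : Graph n} {u v w l₁ l₂} → Walk G u v l₁ → Walk G v w l₂ → Walk G u w (l₁ + l₂)
here     ++ʷ q = q
step e p ++ʷ q = step e (p ++ʷ q)

_▷_ : ∀ {n} {G : Graph n} {u v w l} → Walk G u v l → Edge G v w → Walk G u w (suc l)
here     ▷ e = step e here
step e p ▷ f = step e (p ▷ f)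

reverseʷ : ∀ {n} {G : Graph n} {u v l} → Walk G u v l → Walk G v u l
reverseʷ here = here
reverseʷ {G = G} (step {u} {w} e p) = reverseʷ p ▷ trans (sym G w u) e

diameter-via-centres : ∀ {n} (G : Graph n) {C : Set} (centre : C → Fin n) (d D : ℕ) →
  (∀ u → ∃₂ λ c l → l ≤ d × Walk G u (centre c) l) →
  (∀ c c′ → Walk G (centre c) (centre c′) D) →
  DiameterAtMost G (d + (D + d))
diameter-via-centres G centre d D near between u v
  with near u | near v
... | c , l , l≤d , p | c′ , l′ , l′≤d , p′ =
  l + (D + l′) , +-mono-≤ l≤d (+-mono-≤ (≤-refl {D}) l′≤d) , p ++ʷ (between c c′ ++ʷ reverseʷ p′)

∈-─ : ∀ {A : Set} {x y : A} {ys : List A} (x∈ys : x ∈ ys) → y ∈ ys → y ≢ x → y ∈ ys ─ x∈ys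
∈-─ (here refl) (here refl) y≢x = contradiction refl y≢x
∈-─ (here refl) (there y∈ys) _   = y∈ys
∈-─ (there x∈ys) (here refl) _   = here refl
∈-─ (there x∈ys) (there y∈ys) y≢x = there (∈-─ x∈ys y∈ys y≢x)

count-≤-length : ∀ {A : Set} (f : A → Bool) {xs ys : List A} → Unique xs →
  (∀ {x} → x ∈ xs → f x ≡ true → x ∈ ys) →
  sum (map (λ x → if f x then 1 else 0) xs) ≤ length ys
count-≤-length f {[]} _ _ = z≤n
count-≤-length f {x ∷ xs} {ys} (x∉xs ∷ xs-unique) ⊆ys with f x in fx
... | false = count-≤-length f xs-unique (⊆ys ∘ there)
... | true  = subst (suc _ ≤_) (≡.sym (length-removeAt′ ys _))
  (s≤s (count-≤-length f xs-unique λ x′∈xs fx′ →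
    ∈-─ x∈ys (⊆ys (there x′∈xs) fx′) λ { refl → All.lookup x∉xs x′∈xs refl }))
  where x∈ys = ⊆ys (here refl) fx

degree-≤-length : ∀ {n} (G : Graph n) v (ys : List (Fin n)) →
  (∀ {u} → Edge G v u → u ∈ ys) → degree G v ≤ length ys
degree-≤-length {n} G v ys nbrs = count-≤-length (adj G v) (allFin⁺ n) (λ _ → nbrs)

length-map-allFin : ∀ {A : Set} {m} (f : Fin m → A) → length (map f (allFin m)) ≡ m
length-map-allFin {m = m} f = trans (length-map f (allFin m)) (length-tabulate id)

module Star {n : ℕ} {L : Set} (leaf centre : L → Fin n)
  (leaf-injective : ∀ {ℓ ℓ′} → leaf ℓ ≡ leaf ℓ′ → ℓ ≡ ℓ′)
  (centre≢leaf : ∀ ℓ ℓ′ → centre ℓ ≢ leaf ℓ′) where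

  Joins : Fin n → Fin n → Set
  Joins u v = ∃ λ ℓ → u ≡ leaf ℓ × v ≡ centre ℓ

  StarEdge : Fin n → Fin n → Set
  StarEdge u v = Joins u v ⊎ Joins v u

  joins-functional : ∀ {u v w} → Joins u v → Joins u w → v ≡ w
  joins-functional (ℓ , refl , refl) (ℓ′ , eq , refl) = cong centre (leaf-injective eq)

  joins-unchained : ∀ {u v w} → Joins u v → Joins v w → ⊥
  joins-unchained (ℓ , _ , refl) (ℓ′ , eq , _) = centre≢leaf ℓ ℓ′ eq

  private
    last-link : ∀ {R : Fin n → Fin n → Set} x ys z → Linked R (x ∷ ys ++ [ z ]) →
      ∃ λ w → w ∈ x ∷ ys × R w z
    last-link x []       z (r ∷ _) = x , here refl , r
    last-link x (y ∷ ys) z (_ ∷ l) with last-link y ys z l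
    ... | w , w∈ , r = w , there w∈ , r

  starForest : (G : Graph n) → (∀ {u v} → Edge G u v → StarEdge u v) → Forest G
  starForest G star (v , w₁ ∷ w₂ ∷ ws , _ , (v∉ ∷ w₁∉ ∷ _) , e₁ ∷ e₂ ∷ l)
    with last-link w₂ ws v l
  ... | w , w∈ , e = case₁ (star e₁)
    where
    case₁ : StarEdge v w₁ → ⊥
    case₁ (inj₁ v→w₁) with star e
    ... | inj₁ w→v = joins-unchained w→v v→w₁
    ... | inj₂ v→w = All.lookup w₁∉ w∈ (joins-functional v→w₁ v→w)
    case₁ (inj₂ w₁→v) with star e₂
    ... | inj₁ w₁→w₂ = All.lookup v∉ (there (here refl)) (joins-functional w₁→v w₁→w₂)
    ... | inj₂ w₂→w₁ = joins-unchained w₂→w₁ w₁→v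
  starForest G star (v , _ ∷ [] , s≤s () , _)

  module _ (leaf? : ∀ u → Dec (∃ λ ℓ → u ≡ leaf ℓ)) where

    private
      joins? : Decidable Joins
      joins? u v with leaf? u
      ... | no ¬leaf = no λ (ℓ , u≡ , _) → ¬leaf (ℓ , u≡)
      ... | yes (ℓ , u≡) with v ≟ᶠ centre ℓ
      ...   | yes v≡ = yes (ℓ , u≡ , v≡)
      ...   | no v≢ = no λ j → v≢ (joins-functional j (ℓ , u≡ , refl))

      star? : Decidable StarEdge
      star? u v = joins? u v ⊎-dec joins? v u

      star-sym : Symmetric StarEdge
      star-sym = swap

      star-irrefl : ∀ v → ¬ StarEdge v v
      star-irrefl v (inj₁ j) = joins-unchained j j
      star-irrefl v (inj₂ j) = joins-unchained j j

    open FromRelation star? star-sym star-irrefl public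
      renaming (graph to starGraph)

    starGraph-forest : Forest starGraph
    starGraph-forest = starForest starGraph Edge⇒E

module Incidence {n b : ℕ} {W L : Set} (vertices : Fin n ↔ (W ⊎ L)) (N : L → Fin b → W) where

  open Inverse vertices using (to; from; strictlyInverseʳ)

  word : W → Fin n
  word = from ∘ inj₁

  link : L → Fin n
  link = from ∘ inj₂

  private
    from-injective : ∀ {x y} → from x ≡ from y → x ≡ y
    from-injective = Injection.injective (↔⇒↣ (↔-sym vertices))

    word-injective : ∀ {w w′} → word w ≡ word w′ → w ≡ w′
    word-injective = inj₁-injective ∘ from-injective

    link-injective : ∀ {ℓ ℓ′} → link ℓ ≡ link ℓ′ → ℓ ≡ ℓ′
    link-injective = inj₂-injective ∘ from-injective

    word≢link : ∀ w ℓ → word w ≢ link ℓ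
    word≢link w ℓ eq with from-injective eq
    ... | ()

    link? : ∀ u → Dec (∃ λ ℓ → u ≡ link ℓ)
    link? u with to u in eq
    ... | inj₁ w = no λ (ℓ , u≡) → word≢link w ℓ (trans (cong from (≡.sym eq)) (trans (strictlyInverseʳ u) u≡))
    ... | inj₂ ℓ = yes (ℓ , trans (≡.sym (strictlyInverseʳ u)) (cong from eq))

  module StarAt (t : Fin b) = Star link (λ ℓ → word (N ℓ t)) link-injective (λ ℓ ℓ′ → word≢link (N ℓ t) ℓ′)

  forest : Fin b → Graph n
  forest t = StarAt.starGraph t link?

  G : Graph n
  G = Union.⋃ forest

  arboricity : ArboricityAtMost G b
  arboricity = Union.union-arboricity forest λ t → StarAt.starGraph-forest t link?

  link—word : ∀ ℓ t → Edge G (link ℓ) (word (N ℓ t))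
  link—word ℓ t = Union.E⇒Edge forest (t , StarAt.E⇒Edge t link? (inj₁ (ℓ , refl , refl)))

  private
    edge-star : ∀ {u v} → Edge G u v → ∃ λ t → StarAt.StarEdge t u v
    edge-star e with Union.Edge⇒E forest e
    ... | t , e′ = t , StarAt.Edge⇒E t link? e′

  link-neighbours : ∀ {ℓ v} → Edge G (link ℓ) v → v ∈ map (word ∘ N ℓ) (allFin b)
  link-neighbours {ℓ} e with edge-star e
  ... | t , inj₁ (ℓ′ , ℓ≡ , refl) rewrite link-injective ℓ≡ = ∈-map⁺ (word ∘ N ℓ′) (∈-allFin t)
  ... | t , inj₂ (ℓ′ , _ , ℓ≡) = contradiction (≡.sym ℓ≡) (word≢link (N ℓ′ t) ℓ)

  module _ (ns : W → List L) (ns-complete : ∀ ℓ t → ℓ ∈ ns (N ℓ t)) where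

    word-neighbours : ∀ {w v} → Edge G (word w) v → v ∈ map link (ns w)
    word-neighbours {w} e with edge-star e
    ... | t , inj₁ (ℓ′ , w≡ , _) = contradiction w≡ (word≢link w ℓ′)
    ... | t , inj₂ (ℓ′ , refl , w≡) rewrite word-injective w≡ = ∈-map⁺ link (ns-complete ℓ′ t)

    maxDegree : ∀ {Δ} → b ≤ Δ → (∀ w → length (ns w) ≤ Δ) → MaxDegreeAtMost G Δ
    maxDegree {Δ} b≤Δ ns≤Δ u = subst (λ u → degree G u ≤ Δ) (strictlyInverseʳ u) (byKind (to u))
      where
      byKind : ∀ x → degree G (from x) ≤ Δ
      byKind (inj₁ w) = ≤-trans (degree-≤-length G (word w) _ word-neighbours)
        (subst (_≤ Δ) (≡.sym (length-map link (ns w))) (ns≤Δ w))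
      byKind (inj₂ ℓ) = ≤-trans (degree-≤-length G (link ℓ) _ link-neighbours)
        (subst (_≤ Δ) (≡.sym (length-map-allFin (word ∘ N ℓ))) b≤Δ)

^-distribʳ-* : ∀ m n o → (m * n) ^ o ≡ m ^ o * n ^ o
^-distribʳ-* m n zero    = refl
^-distribʳ-* m n (suc o) = trans (cong (m * n *_) (^-distribʳ-* m n o)) (interchange m n (m ^ o) (n ^ o))
  where
  interchange : ∀ a b c d → a * b * (c * d) ≡ a * c * (b * d)
  interchange = solve-∀

module _ {A : Set} where

  shift : ∀ {r} → Vec A (suc r) → A → Vec A (suc r)
  shift x c = tail x ∷ʳ c

  shiftAll : ∀ {r m} → Vec A (suc r) → Vec A m → Vec A (suc r)
  shiftAll x []       = x
  shiftAll x (c ∷ cs) = shiftAll (shift x c) cs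

  shiftAll-∷ʳ : ∀ {r m} (x : Vec A (suc r)) (cs : Vec A m) c →
    shiftAll x (cs ∷ʳ c) ≡ shift (shiftAll x cs) c
  shiftAll-∷ʳ x []       c = refl
  shiftAll-∷ʳ x (d ∷ cs) c = shiftAll-∷ʳ (shift x d) cs c

  tail-shift : ∀ {r} (x : Vec A (suc (suc r))) c → tail (shift x c) ≡ shift (tail x) c
  tail-shift (_ ∷ _ ∷ _) c = refl

  tail-shiftAll : ∀ {r m} (x : Vec A (suc (suc r))) (cs : Vec A m) →
    tail (shiftAll x cs) ≡ shiftAll (tail x) cs
  tail-shiftAll x []       = refl
  tail-shiftAll x (c ∷ cs) = trans (tail-shiftAll (shift x c) cs) (cong (λ y → shiftAll y cs) (tail-shift x c))

  shiftAll-self : ∀ {r} (x z : Vec A (suc r)) → shiftAll x z ≡ z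
  shiftAll-self {zero}  (_ ∷ []) (_ ∷ []) = refl
  shiftAll-self {suc r} x z with initLast z
  ... | zs , c , refl = begin
    shiftAll x (zs ∷ʳ c)        ≡⟨ shiftAll-∷ʳ x zs c ⟩
    tail (shiftAll x zs) ∷ʳ c   ≡⟨ cong (_∷ʳ c) (tail-shiftAll x zs) ⟩
    shiftAll (tail x) zs ∷ʳ c   ≡⟨ cong (_∷ʳ c) (shiftAll-self (tail x) zs) ⟩
    zs ∷ʳ c                     ∎
    where open ≡.≡-Reasoning

  Fin^↔Vec : ∀ {a} → Fin a ↔ A → ∀ r → Fin (a ^ r) ↔ Vec A r
  Fin^↔Vec A↔ zero    = mk↔ₛ′ (λ _ → []) (λ _ → zero) (λ { [] → refl }) (λ { zero → refl })
  Fin^↔Vec A↔ (suc r) = ↔-trans *↔× (↔-trans (A↔ ×-↔ Fin^↔Vec A↔ r) ×↔∷)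
    where
    ×↔∷ : (A × Vec A r) ↔ Vec A (suc r)
    ×↔∷ = mk↔ₛ′ (uncurry _∷_) uncons (λ { (_ ∷ _) → refl }) (λ _ → refl)

module ShiftGraph (P Q r : ℕ) where

  Letter : Set
  Letter = Fin P × Fin Q

  Word : Set
  Word = Vec Letter (suc r)

  Link : Set
  Link = Fin P × Vec Letter r × Fin P

  linkNeighbour : Link → Fin Q × Fin 2 → Word
  linkNeighbour (s , y , p) (q , 0F) = (s , q) ∷ y
  linkNeighbour (s , y , p) (q , 1F) = y ∷ʳ (p , q)

  wordNeighbours : Word → List Link
  wordNeighbours x =
    map (λ p → proj₁ (head x) , tail x , p) (allFin P) ++
    map (λ s → s , init x , proj₁ (last x)) (allFin P)

  wordNeighbours-complete : ∀ ℓ i → ℓ ∈ wordNeighbours (linkNeighbour ℓ i)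
  wordNeighbours-complete (s , y , p) (q , 0F) = ∈-++⁺ˡ (∈-map⁺ (λ p → s , y , p) (∈-allFin p))
  wordNeighbours-complete (s , y , p) (q , 1F) rewrite init-∷ʳ (p , q) y | last-∷ʳ (p , q) y =
    ∈-++⁺ʳ _ (∈-map⁺ (λ s → s , y , p) (∈-allFin s))

  length-wordNeighbours : ∀ x → length (wordNeighbours x) ≡ P * 2
  length-wordNeighbours x = begin
    length (map f (allFin P) ++ map g (allFin P))      ≡⟨ length-++ (map f (allFin P)) ⟩
    length (map f (allFin P)) + length (map g (allFin P))
      ≡⟨ cong₂ _+_ (length-map-allFin f) (length-map-allFin g) ⟩
    P + P                                              ≡⟨ double P ⟩
    P * 2                                              ∎
    where
    open ≡.≡-Reasoning
    f = λ p → proj₁ (head x) , tail x , p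
    g = λ s → s , init x , proj₁ (last x)
    double : ∀ m → m + m ≡ m * 2
    double = solve-∀

  wordCount linkCount : ℕ
  wordCount = (P * Q) ^ suc r
  linkCount = P * ((P * Q) ^ r * P)

  vertices : Fin (wordCount + linkCount) ↔ (Word ⊎ Link)
  vertices = ↔-trans +↔⊎ (Fin^↔Vec *↔× (suc r) ⊎-↔ links)
    where
    links : Fin linkCount ↔ Link
    links = ↔-trans *↔× (↔-refl ×-↔ ↔-trans *↔× (Fin^↔Vec *↔× r ×-↔ ↔-refl))

  N : Link → Fin (Q * 2) → Word
  N ℓ t = linkNeighbour ℓ (Inverse.to *↔× t)

  open Incidence vertices N public using (G; word; link; arboricity)

  maxDegree : Q * 2 ≤ P * 2 → MaxDegreeAtMost G (P * 2)
  maxDegree b≤Δ = Incidence.maxDegree vertices N wordNeighbours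
    (λ ℓ t → wordNeighbours-complete ℓ (Inverse.to *↔× t))
    b≤Δ (λ x → ≤-reflexive (length-wordNeighbours x))

  link—word : ∀ ℓ i → Edge G (link ℓ) (word (linkNeighbour ℓ i))
  link—word ℓ i = subst (λ j → Edge G (link ℓ) (word (linkNeighbour ℓ j)))
    (Inverse.strictlyInverseˡ *↔× i) (Incidence.link—word vertices N ℓ (Inverse.from *↔× i))

  word—link : ∀ ℓ i → Edge G (word (linkNeighbour ℓ i)) (link ℓ)
  word—link ℓ i = trans (sym G _ _) (link—word ℓ i)

  shift-walk : ∀ x c → Walk G (word x) (word (shift x c)) 2
  shift-walk ((s , q₀) ∷ y) (p , q) = step (word—link ℓ (q₀ , 0F)) (step (link—word ℓ (q , 1F)) here)
    where ℓ = s , y , p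

  shiftAll-walk : ∀ {m} x (cs : Vec Letter m) → Walk G (word x) (word (shiftAll x cs)) (m * 2)
  shiftAll-walk x []       = here
  shiftAll-walk x (c ∷ cs) = shift-walk x c ++ʷ shiftAll-walk (shift x c) cs

  word-walk : ∀ x z → Walk G (word x) (word z) (suc r * 2)
  word-walk x z = subst (λ w → Walk G (word x) (word w) _) (shiftAll-self x z) (shiftAll-walk x z)

  diameter : Fin Q → DiameterAtMost G (suc (suc r) * 2)
  diameter q = subst (DiameterAtMost G) (length-bound r)
    (diameter-via-centres G word 1 (suc r * 2) near-word word-walk)
    where
    open Inverse vertices using (to; from; strictlyInverseʳ)

    near-word : ∀ u → ∃₂ λ x l → l ≤ 1 × Walk G u (word x) l
    near-word u = subst (λ u → ∃₂ λ x l → l ≤ 1 × Walk G u (word x) l) (strictlyInverseʳ u) (byKind (to u))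
      where
      byKind : ∀ v → ∃₂ λ x l → l ≤ 1 × Walk G (from v) (word x) l
      byKind (inj₁ x) = x , 0 , z≤n , here
      byKind (inj₂ ℓ) = linkNeighbour ℓ (q , 0F) , 1 , ≤-refl , step (link—word ℓ (q , 0F)) here

    length-bound : ∀ r → 1 + (suc r * 2 + 1) ≡ suc (suc r) * 2
    length-bound = solve-∀

  vertexCount-bound : 8 * (Q * 2 * (P * 2)) ^ (2 + r) ≤ (wordCount + linkCount) * ((Q * 2) ^ 2 * 8 ^ (2 + r))
  vertexCount-bound = begin
    8 * A ^ (2 + r)                             ≡⟨ cong (λ y → 8 * (A * (A * y))) A^r ⟩
    8 * (A * (A * ((P * Q) ^ r * 4 ^ r)))       ≡⟨ grow P Q ((P * Q) ^ r) (4 ^ r) ⟩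
    128 * (T * 4 ^ r)                            ≤⟨ *-mono-≤ (m≤n+m 128 128) (*-monoʳ-≤ T (^-monoˡ-≤ r 4≤8)) ⟩
    256 * (T * 8 ^ r)                            ≡⟨ shrink P Q ((P * Q) ^ r) (8 ^ r) ⟨
    linkCount * ((Q * 2) ^ 2 * 8 ^ (2 + r))      ≤⟨ *-monoˡ-≤ _ (m≤n+m linkCount wordCount) ⟩
    (wordCount + linkCount) * ((Q * 2) ^ 2 * 8 ^ (2 + r)) ∎
    where
    open ≤-Reasoning
    A = Q * 2 * (P * 2)
    T = P * P * (Q * Q) * (P * Q) ^ r

    A^r : A ^ r ≡ (P * Q) ^ r * 4 ^ r
    A^r = trans (cong (_^ r) (regroup P Q)) (^-distribʳ-* (P * Q) 4 r)
      where
      regroup : ∀ P Q → Q * 2 * (P * 2) ≡ P * Q * 4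
      regroup = solve-∀

    grow : ∀ P Q X F → 8 * (Q * 2 * (P * 2) * (Q * 2 * (P * 2) * (X * F))) ≡ 128 * (P * P * (Q * Q) * X * F)
    grow = solve-∀

    shrink : ∀ P Q X E → P * (X * P) * (Q * 2 * (Q * 2 * 1) * (8 * (8 * E))) ≡ 256 * (P * P * (Q * Q) * X * E)
    shrink = solve-∀

    4≤8 : 4 ≤ 8
    4≤8 = m≤n+m 4 4

mainTheorem2 : (b k Δ : ℕ) → 2 ∣ b → 2 ∣ k → 2 ∣ Δ →
    2 ≤ b → 4 ≤ k → b ≤ Δ → (Δ % 4 ≡ 2 ⊎ b % 4 ≡ 0) →
    Σ ℕ λ n → Σ (Graph n) λ G →
      ArboricityAtMost G b × MaxDegreeAtMost G Δ × DiameterAtMost G k ×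
      (8 * (b * Δ) ^ (k / 2) ≤ n * (b ^ 2 * 8 ^ (k / 2)))
mainTheorem2 _ _ _ (divides zero refl) _ _ () _ _ _
mainTheorem2 _ _ _ _ (divides zero refl) _ _ () _ _
mainTheorem2 _ _ _ _ (divides 1 refl) _ _ (s≤s (s≤s ())) _ _
mainTheorem2 _ _ _ (divides (suc Q) refl) (divides (suc (suc r)) refl) (divides P refl) _ _ b≤Δ _ =
  wordCount + linkCount , G , arboricity , maxDegree b≤Δ , diameter zero ,
  subst (λ e → 8 * (suc Q * 2 * (P * 2)) ^ e ≤ (wordCount + linkCount) * ((suc Q * 2) ^ 2 * 8 ^ e))
    (≡.sym (m*n/n≡m (2 + r) 2)) vertexCount-bound
  where open ShiftGraph P (suc Q) r
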